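{- If $\mathcal{D}$ witnesses $\vdash_{\mathsf{GT}} \Gamma \Rightarrow \Delta$, there is an effective procedure for transforming $\mathcal{D}$ into a derivation $\mathcal{D}'$ witnessing $\vdash_{\mathsf{GT}^- } \Gamma \Rightarrow \Delta$.
   Context: Classical formulas: $\alpha::=p\mid\bot\mid\neg\alpha\mid\alpha\wedge\alpha\mid\alpha\vee\alpha$; formulas of $\mathbf{PL}(\mathbin{\backslash\!\!\!/})$: $\phi::=\alpha\mid\phi\wedge\phi\mid\phi\vee\phi\mid\phi\mathbin{\backslash\!\!\!/}\phi$ ($\vee$ split disjunction, $\mathbin{\backslash\!\!\!/}$ inquisitive disjunction). $\mathsf{GT}$ ($\alpha$ classical, $\Lambda$ a multiset of classical formulas) has axioms $\Gamma,p\Rightarrow p,\Delta$, $\Gamma,\bot\Rightarrow\Delta$ and rules $\mathsf{L}\neg$ ($\Gamma\Rightarrow\alpha,\Delta$ / $\Gamma,\neg\alpha\Rightarrow\Delta$), $\mathsf{R}\neg$ ($\Gamma,\alpha\Rightarrow\Delta$ / $\Gamma\Rightarrow\neg\alpha,\Delta$), $\mathsf{L}\wedge$ ($\Gamma,\phi,\psi\Rightarrow\Delta$ / $\Gamma,\phi\wedge\psi\Rightarrow\Delta$), $\mathsf{R}\wedge$ ($\Gamma\Rightarrow\phi,\Lambda$ and $\Gamma\Rightarrow\psi,\Lambda$ / $\Gamma\Rightarrow\phi\wedge\psi,\Lambda,\Delta$), $\mathsf{L}\vee$ ($\Gamma,\phi\Rightarrow\Lambda$ and $\Gamma,\psi\Rightarrow\Lambda$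 / $\Gamma,\phi\vee\psi\Rightarrow\Lambda,\Delta$), $\mathsf{R}\vee$ ($\Gamma\Rightarrow\phi,\psi,\Delta$ / $\Gamma\Rightarrow\phi\vee\psi,\Delta$), $\mathsf{L}\mathbin{\backslash\!\!\!/}$ ($\Gamma,\chi\{\phi_L\}\Rightarrow\Delta$ and $\Gamma,\chi\{\phi_R\}\Rightarrow\Delta$ / $\Gamma,\chi\{\phi_L\mathbin{\backslash\!\!\!/}\phi_R\}\Rightarrow\Delta$), $\mathsf{R}\mathbin{\backslash\!\!\!/}$ ($\Gamma\Rightarrow\chi\{\phi_i\},\Delta$, $i\in\{L,R\}$ / $\Gamma\Rightarrow\chi\{\phi_L\mathbin{\backslash\!\!\!/}\phi_R\},\Delta$), and $\mathsf{Cut}$ ($\Gamma\Rightarrow\phi,\Delta$ and $\Pi,\phi\Rightarrow\Sigma$ / $\Pi,\Gamma\Rightarrow\Delta,\Sigma$), where $\chi\{\eta\}$ replaces a fixed subformula occurrence of $\chi$ not in the scope of a negation by $\eta$. $\mathsf{GT}^-$ is $\mathsf{GT}$ without $\mathsf{Cut}$. -}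

module Defs where

open import Data.Nat using (ℕ)
open import Data.Bool using (Bool; true; false)
open import Data.List using (List; []; _∷_; _++_)
open import Data.List.Relation.Unary.All using (All)
open import Data.List.Relation.Binary.Permutation.Propositional using (_↭_)

infixr 8 _∧'_
infixr 7 _∨'_ _⩔_

-- Formulas of PL(⩔).  Negation may only be applied to classical formulas,
-- so Formula and the predicate Classical are defined mutually.
data Formula : Set
data Classical : Formula → Set

data Formula where
  var  : ℕ → Formula
  ⊥'   : Formula
  ¬'   : (α : Formula) → Classical α → Formula
  _∧'_ : Formula → Formula → Formula
  _∨'_ : Formula → Formula → Formula
  _⩔_  : Formula → Formula → Formula

data Classical where
  var : ∀ n → Classical (var n)
  ⊥'  : Classical ⊥'
  ¬'  : ∀ {α} (c : Classical α) → Classical (¬' α c)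
  _∧'_ : ∀ {α β} → Classical α → Classical β → Classical (α ∧' β)
  _∨'_ : ∀ {α β} → Classical α → Classical β → Classical (α ∨' β)

-- One-hole contexts χ{ } whose hole (a fixed subformula occurrence) is not
-- in the scope of a negation: there is no case for ¬'.
data Ctx : Set where
  hole : Ctx
  _∧ˡ_ : Ctx → Formula → Ctx
  _∧ʳ_ : Formula → Ctx → Ctx
  _∨ˡ_ : Ctx → Formula → Ctx
  _∨ʳ_ : Formula → Ctx → Ctx
  _⩔ˡ_ : Ctx → Formula → Ctx
  _⩔ʳ_ : Formula → Ctx → Ctx

plug : Ctx → Formula → Formula
plug hole η = η
plug (χ ∧ˡ ψ) η = plug χ η ∧' ψ
plug (φ ∧ʳ χ) η = φ ∧' plug χ η
plug (χ ∨ˡ ψ) η = plug χ η ∨' ψ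
plug (φ ∨ʳ χ) η = φ ∨' plug χ η
plug (χ ⩔ˡ ψ) η = plug χ η ⩔ ψ
plug (φ ⩔ʳ χ) η = φ ⩔ plug χ η

-- Sequents are pairs of multisets, represented as lists
-- identified up to permutation (the `perm` constructor realises multiset
-- identity; it is not a proper rule).  The Bool index says whether Cut may
-- be used: GT true = GT, GT false = GT⁻ (cut-free).
data GT : Bool → List Formula → List Formula → Set where
  perm : ∀ {b Γ Γ' Δ Δ'} → Γ ↭ Γ' → Δ ↭ Δ' → GT b Γ Δ → GT b Γ' Δ'
  ax   : ∀ {b Γ Δ} n → GT b (var n ∷ Γ) (var n ∷ Δ)
  ax⊥  : ∀ {b Γ Δ} → GT b (⊥' ∷ Γ) Δ
  L¬   : ∀ {b Γ Δ α} (c : Classical α) → GT b Γ (α ∷ Δ) → GT b (¬' α c ∷ Γ) Δ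
  R¬   : ∀ {b Γ Δ α} (c : Classical α) → GT b (α ∷ Γ) Δ → GT b Γ (¬' α c ∷ Δ)
  L∧   : ∀ {b Γ Δ φ ψ} → GT b (φ ∷ ψ ∷ Γ) Δ → GT b (φ ∧' ψ ∷ Γ) Δ
  R∧   : ∀ {b Γ Λ Δ φ ψ} → All Classical Λ →
         GT b Γ (φ ∷ Λ) → GT b Γ (ψ ∷ Λ) → GT b Γ (φ ∧' ψ ∷ Λ ++ Δ)
  L∨   : ∀ {b Γ Λ Δ φ ψ} → All Classical Λ →
         GT b (φ ∷ Γ) Λ → GT b (ψ ∷ Γ) Λ → GT b (φ ∨' ψ ∷ Γ) (Λ ++ Δ)
  R∨   : ∀ {b Γ Δ φ ψ} → GT b Γ (φ ∷ ψ ∷ Δ) → GT b Γ (φ ∨' ψ ∷ Δ)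
  L⩔   : ∀ {b Γ Δ} (χ : Ctx) φL φR →
         GT b (plug χ φL ∷ Γ) Δ → GT b (plug χ φR ∷ Γ) Δ →
         GT b (plug χ (φL ⩔ φR) ∷ Γ) Δ
  R⩔ˡ  : ∀ {b Γ Δ} (χ : Ctx) φL φR →
         GT b Γ (plug χ φL ∷ Δ) → GT b Γ (plug χ (φL ⩔ φR) ∷ Δ)
  R⩔ʳ  : ∀ {b Γ Δ} (χ : Ctx) φL φR →
         GT b Γ (plug χ φR ∷ Δ) → GT b Γ (plug χ (φL ⩔ φR) ∷ Δ)
  cut  : ∀ {Γ Δ Π Σ} φ → GT true Γ (φ ∷ Δ) → GT true (φ ∷ Π) Σ →
         GT true (Π ++ Γ) (Δ ++ Σ)

{-# OPTIONS --safe #-}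
-- A resolution of a formula is a classical formula obtained by choosing one disjunct
-- of every ⩔ in it.  Every rule of GT, Cut included, preserves resolution validity:
-- each resolution f of the antecedent classically entails some resolution g of the
-- succedent.  A classically valid classical sequent f ⇒ g is reduced to axioms by the
-- invertible rules, without Cut, and L⩔ and R⩔ then lift the cut-free derivations of
-- all these f ⇒ g back to Γ ⇒ Δ.  Each step is a structurally recursive total
-- function, so their composite is the effective procedure.
module Submission where

open import Defs
open import Data.Bool using (Bool; true; false; T)
open import Data.Empty using (⊥; ⊥-elim)
open import Data.Nat using (ℕ; _≟_)
open import Data.List using (List; []; _∷_; _++_; map)
open import Data.List.Properties using (++-identityʳ)
open import Data.List.Membership.Propositional using (_∈_; find; lose)
open import Data.List.Membership.Propositional.Properties using (∈-map⁺)
open import Data.List.Membership.DecPropositional _≟_ using (_∈?_)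
open import Data.List.Relation.Unary.All as All using (All; []; _∷_)
open import Data.List.Relation.Unary.All.Properties using (++⁺; ++⁻ˡ; ++⁻ʳ; All¬⇒¬Any)
open import Data.List.Relation.Unary.Any as Any using (Any; here; there; any?)
open import Data.List.Relation.Unary.Any.Properties using (++⁺ˡ; ++⁺ʳ)
open import Data.List.Relation.Binary.Pointwise as Pointwise using (Pointwise; []; _∷_)
open import Data.List.Relation.Binary.Permutation.Propositional
  using (_↭_; refl; prep; swap; trans; ↭-refl; ↭-sym; ↭-trans)
open import Data.List.Relation.Binary.Permutation.Propositional.Properties
  using (All-resp-↭; Any-resp-↭; shift)
open import Data.Product using (_×_; _,_; proj₁; proj₂; ∃; ∃-syntax; ∃₂; uncurry)
open import Data.Sum as Sum using (_⊎_; inj₁; inj₂; [_,_]; [_,_]′)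
open import Function using (_∘_; id; case_of_)
open import Relation.Nullary using (¬_; Dec; yes; no)
open import Relation.Nullary.Decidable using (T?; ¬?; _×-dec_; _⊎-dec_; isYes; fromWitness; toWitness)
open import Relation.Binary.PropositionalEquality using (_≡_; refl; cong; subst; subst₂; sym)

private variable
  b : Bool
  φ ψ α η η′ φL φR a : Formula
  Γ Γ′ Δ Δ′ Θ Λ Π Σ f g : List Formula
  A B : List ℕ

∈⇒↭-∷ : ∀ {X : Set} {x : X} {xs} → x ∈ xs → ∃[ ys ] (xs ↭ x ∷ ys)
∈⇒↭-∷ (here refl)  = _ , ↭-refl
∈⇒↭-∷ (there x∈xs) =
  let ys , p = ∈⇒↭-∷ x∈xs in _ ∷ ys , ↭-trans (prep _ p) (swap _ _ ↭-refl)

module _ {X Y : Set} {R : X → Y → Set} where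

  Pointwise-↭ : ∀ {xs xs′ ys} → xs ↭ xs′ → Pointwise R xs ys →
                ∃[ ys′ ] Pointwise R xs′ ys′ × ys ↭ ys′
  Pointwise-↭ refl         rs           = _ , rs , ↭-refl
  Pointwise-↭ (prep _ p)   (r ∷ rs)     =
    let _ , rs′ , q = Pointwise-↭ p rs in _ , r ∷ rs′ , prep _ q
  Pointwise-↭ (swap _ _ p) (r ∷ s ∷ rs) =
    let _ , rs′ , q = Pointwise-↭ p rs in _ , s ∷ r ∷ rs′ , swap _ _ q
  Pointwise-↭ (trans p p′) rs           =
    let _ , rs₁ , q₁ = Pointwise-↭ p rs
        _ , rs₂ , q₂ = Pointwise-↭ p′ rs₁
    in _ , rs₂ , ↭-trans q₁ q₂

  Pointwise-++⁻ : ∀ xs {xs′ ys} → Pointwise R (xs ++ xs′) ys →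
                  ∃₂ λ zs zs′ → ys ≡ zs ++ zs′ × Pointwise R xs zs × Pointwise R xs′ zs′
  Pointwise-++⁻ []       rs       = _ , _ , refl , [] , rs
  Pointwise-++⁻ (_ ∷ xs) (r ∷ rs) with _ , _ , refl , rs₁ , rs₂ ← Pointwise-++⁻ xs rs =
    _ , _ , refl , r ∷ rs₁ , rs₂

permˡ : Γ ↭ Γ′ → GT b Γ Δ → GT b Γ′ Δ
permˡ p = perm p ↭-refl

permʳ : Δ ↭ Δ′ → GT b Γ Δ → GT b Γ Δ′
permʳ = perm ↭-refl

exchangeʳ : GT b Γ (φ ∷ ψ ∷ Δ) → GT b Γ (ψ ∷ φ ∷ Δ)
exchangeʳ = permʳ (swap _ _ ↭-refl)

R∧′ : All Classical Λ → GT b Γ (φ ∷ Λ) → GT b Γ (ψ ∷ Λ) → GT b Γ (φ ∧' ψ ∷ Λ)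
R∧′ {Λ = Λ} cΛ d₁ d₂ = subst (GT _ _ ∘ (_ ∷_)) (++-identityʳ Λ) (R∧ {Δ = []} cΛ d₁ d₂)

L∨′ : All Classical Λ → GT b (φ ∷ Γ) Λ → GT b (ψ ∷ Γ) Λ → GT b (φ ∨' ψ ∷ Γ) Λ
L∨′ {Λ = Λ} cΛ d₁ d₂ = subst (GT _ _) (++-identityʳ Λ) (L∨ {Δ = []} cΛ d₁ d₂)

weakenʳ : GT b Γ Δ → GT b Γ (φ ∷ Δ)
weakenʳ (perm p q d)          = perm p (prep _ q) (weakenʳ d)
weakenʳ (ax n)                = exchangeʳ (ax n)
weakenʳ ax⊥                   = ax⊥
weakenʳ (L¬ c d)              = L¬ c (exchangeʳ (weakenʳ d))
weakenʳ (R¬ c d)              = exchangeʳ (R¬ c (weakenʳ d))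
weakenʳ (L∧ d)                = L∧ (weakenʳ d)
weakenʳ (R∧ {Λ = Λ} cΛ d₁ d₂) = permʳ (shift _ (_ ∷ Λ) _) (R∧ cΛ d₁ d₂)
weakenʳ (L∨ {Λ = Λ} cΛ d₁ d₂) = permʳ (shift _ Λ _) (L∨ cΛ d₁ d₂)
weakenʳ (R∨ d)                = exchangeʳ (R∨ (permʳ (↭-sym (shift _ (_ ∷ _ ∷ []) _)) (weakenʳ d)))
weakenʳ (L⩔ χ φL φR d₁ d₂)    = L⩔ χ φL φR (weakenʳ d₁) (weakenʳ d₂)
weakenʳ (R⩔ˡ χ φL φR d)       = exchangeʳ (R⩔ˡ χ φL φR (exchangeʳ (weakenʳ d)))
weakenʳ (R⩔ʳ χ φL φR d)       = exchangeʳ (R⩔ʳ χ φL φR (exchangeʳ (weakenʳ d)))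
weakenʳ (cut φ d₁ d₂)         = cut φ (exchangeʳ (weakenʳ d₁)) d₂

ax-∈ : ∀ {n} → var n ∈ Γ → var n ∈ Δ → GT b Γ Δ
ax-∈ {n = n} n∈Γ n∈Δ = perm (↭-sym (proj₂ (∈⇒↭-∷ n∈Γ))) (↭-sym (proj₂ (∈⇒↭-∷ n∈Δ))) (ax n)

-- Truth and resolutions

Valuation : Set
Valuation = ℕ → Bool

_⊨_ : Valuation → Formula → Set
v ⊨ var n    = T (v n)
v ⊨ ⊥'       = ⊥
v ⊨ ¬' α _   = ¬ (v ⊨ α)
v ⊨ (φ ∧' ψ) = v ⊨ φ × v ⊨ ψ
v ⊨ (φ ∨' ψ) = v ⊨ φ ⊎ v ⊨ ψ
v ⊨ (φ ⩔ ψ)  = v ⊨ φ ⊎ v ⊨ ψ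

_⊨?_ : ∀ v φ → Dec (v ⊨ φ)
v ⊨? var n    = T? (v n)
v ⊨? ⊥'       = no λ ()
v ⊨? ¬' α _   = ¬? (v ⊨? α)
v ⊨? (φ ∧' ψ) = (v ⊨? φ) ×-dec (v ⊨? ψ)
v ⊨? (φ ∨' ψ) = (v ⊨? φ) ⊎-dec (v ⊨? ψ)
v ⊨? (φ ⩔ ψ)  = (v ⊨? φ) ⊎-dec (v ⊨? ψ)

Entails : List Formula → List Formula → Set
Entails Γ Δ = ∀ v → All (v ⊨_) Γ → Any (v ⊨_) Δ

data Resolution : Formula → Formula → Set where
  var  : ∀ n → Resolution (var n) (var n)
  ⊥'   : Resolution ⊥' ⊥'
  ¬'   : ∀ α c → Resolution (¬' α c) (¬' α c)
  _∧'_ : ∀ {φ ψ a b} → Resolution φ a → Resolution ψ b → Resolution (φ ∧' ψ) (a ∧' b)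
  _∨'_ : ∀ {φ ψ a b} → Resolution φ a → Resolution ψ b → Resolution (φ ∨' ψ) (a ∨' b)
  inl  : ∀ {φ ψ a} → Resolution φ a → Resolution (φ ⩔ ψ) a
  inr  : ∀ {φ ψ a} → Resolution ψ a → Resolution (φ ⩔ ψ) a

Resolutions : List Formula → List Formula → Set
Resolutions = Pointwise Resolution

resolution-classical : Resolution φ a → Classical a
resolution-classical (var n)  = var n
resolution-classical ⊥'       = ⊥'
resolution-classical (¬' _ c) = ¬' c
resolution-classical (r ∧' s) = resolution-classical r ∧' resolution-classical s
resolution-classical (r ∨' s) = resolution-classical r ∨' resolution-classical s
resolution-classical (inl r)  = resolution-classical r
resolution-classical (inr r)  = resolution-classical r

resolution-refl : Classical α → Resolution α α
resolution-refl (var n)  = var n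
resolution-refl ⊥'       = ⊥'
resolution-refl (¬' c)   = ¬' _ c
resolution-refl (c ∧' d) = resolution-refl c ∧' resolution-refl d
resolution-refl (c ∨' d) = resolution-refl c ∨' resolution-refl d

classical-resolution : Classical α → Resolution α a → a ≡ α
classical-resolution (var n)  (var n)   = refl
classical-resolution ⊥'       ⊥'        = refl
classical-resolution (¬' c)   (¬' _ _)  = refl
classical-resolution (c ∧' d) (r ∧' s)
  with refl ← classical-resolution c r | refl ← classical-resolution d s = refl
classical-resolution (c ∨' d) (r ∨' s)
  with refl ← classical-resolution c r | refl ← classical-resolution d s = refl

resolution-exists : ∀ φ → ∃ (Resolution φ)
resolution-exists (var n)  = _ , var n
resolution-exists ⊥'       = _ , ⊥'
resolution-exists (¬' α c) = _ , ¬' α c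
resolution-exists (φ ∧' ψ) = _ , proj₂ (resolution-exists φ) ∧' proj₂ (resolution-exists ψ)
resolution-exists (φ ∨' ψ) = _ , proj₂ (resolution-exists φ) ∨' proj₂ (resolution-exists ψ)
resolution-exists (φ ⩔ ψ)  = _ , inl (proj₂ (resolution-exists φ))

resolutions-classical : Resolutions Γ f → All Classical f
resolutions-classical []       = []
resolutions-classical (r ∷ rs) = resolution-classical r ∷ resolutions-classical rs

classical-resolutions : All Classical Λ → Resolutions Λ g → g ≡ Λ
classical-resolutions [] [] = refl
classical-resolutions (c ∷ cs) (r ∷ rs)
  with refl ← classical-resolution c r | refl ← classical-resolutions cs rs = refl

resolutions-exist : ∀ Γ → ∃ (Resolutions Γ)
resolutions-exist []      = _ , []
resolutions-exist (φ ∷ Γ) = _ , proj₂ (resolution-exists φ) ∷ proj₂ (resolutions-exist Γ)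

resolution-plug : ∀ χ → (∀ {a} → Resolution η a → Resolution η′ a) →
                  Resolution (plug χ η) a → Resolution (plug χ η′) a
resolution-plug hole     ρ r        = ρ r
resolution-plug (χ ∧ˡ _) ρ (r ∧' s) = resolution-plug χ ρ r ∧' s
resolution-plug (_ ∧ʳ χ) ρ (r ∧' s) = r ∧' resolution-plug χ ρ s
resolution-plug (χ ∨ˡ _) ρ (r ∨' s) = resolution-plug χ ρ r ∨' s
resolution-plug (_ ∨ʳ χ) ρ (r ∨' s) = r ∨' resolution-plug χ ρ s
resolution-plug (χ ⩔ˡ _) ρ (inl r)  = inl (resolution-plug χ ρ r)
resolution-plug (χ ⩔ˡ _) ρ (inr r)  = inr r
resolution-plug (_ ⩔ʳ χ) ρ (inl r)  = inl r
resolution-plug (_ ⩔ʳ χ) ρ (inr r)  = inr (resolution-plug χ ρ r)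

resolution-plug-⩔ : ∀ χ → Resolution (plug χ (φL ⩔ φR)) a →
                    Resolution (plug χ φL) a ⊎ Resolution (plug χ φR) a
resolution-plug-⩔ hole     (inl r)  = inj₁ r
resolution-plug-⩔ hole     (inr r)  = inj₂ r
resolution-plug-⩔ (χ ∧ˡ _) (r ∧' s) = Sum.map (_∧' s) (_∧' s) (resolution-plug-⩔ χ r)
resolution-plug-⩔ (_ ∧ʳ χ) (r ∧' s) = Sum.map (r ∧'_) (r ∧'_) (resolution-plug-⩔ χ s)
resolution-plug-⩔ (χ ∨ˡ _) (r ∨' s) = Sum.map (_∨' s) (_∨' s) (resolution-plug-⩔ χ r)
resolution-plug-⩔ (_ ∨ʳ χ) (r ∨' s) = Sum.map (r ∨'_) (r ∨'_) (resolution-plug-⩔ χ s)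
resolution-plug-⩔ (χ ⩔ˡ _) (inl r)  = Sum.map inl inl (resolution-plug-⩔ χ r)
resolution-plug-⩔ (χ ⩔ˡ _) (inr r)  = inj₁ (inr r)
resolution-plug-⩔ (_ ⩔ʳ χ) (inl r)  = inj₁ (inl r)
resolution-plug-⩔ (_ ⩔ʳ χ) (inr r)  = Sum.map inr inr (resolution-plug-⩔ χ r)

-- Soundness of GT for resolution validity

Valid : List Formula → List Formula → Set
Valid Γ Δ = ∀ {f} → Resolutions Γ f → ∃[ g ] Resolutions Δ g × Entails f g

valid-perm : Γ ↭ Γ′ → Δ ↭ Δ′ → Valid Γ Δ → Valid Γ′ Δ′
valid-perm p q ⊨ΓΔ rf′ =
  let _ , rf , f′↭f    = Pointwise-↭ (↭-sym p) rf′
      _ , rg , f⊨g     = ⊨ΓΔ rf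
      g′ , rg′ , g↭g′  = Pointwise-↭ q rg
  in g′ , rg′ , λ v ⊨f′ → Any-resp-↭ g↭g′ (f⊨g v (All-resp-↭ f′↭f ⊨f′))

valid-ax : ∀ n → Valid (var n ∷ Γ) (var n ∷ Δ)
valid-ax {Δ = Δ} n (var n ∷ _) =
  let _ , rg = resolutions-exist Δ in _ , var n ∷ rg , λ { v (⊨n ∷ _) → here ⊨n }

valid-ax⊥ : Valid (⊥' ∷ Γ) Δ
valid-ax⊥ {Δ = Δ} (⊥' ∷ _) = let _ , rg = resolutions-exist Δ in _ , rg , λ { v (() ∷ _) }

valid-L¬ : (c : Classical α) → Valid Γ (α ∷ Δ) → Valid (¬' α c ∷ Γ) Δ
valid-L¬ c ⊨ΓαΔ (¬' _ _ ∷ rf) with _ ∷ g , r ∷ rg , f⊨ag ← ⊨ΓαΔ rf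
  with refl ← classical-resolution c r =
  g , rg , λ { v (⊭α ∷ ⊨f) → Any.tail ⊭α (f⊨ag v ⊨f) }

valid-R¬ : (c : Classical α) → Valid (α ∷ Γ) Δ → Valid Γ (¬' α c ∷ Δ)
valid-R¬ {α = α} c ⊨αΓΔ rf =
  let g , rg , αf⊨g = ⊨αΓΔ (resolution-refl c ∷ rf)
  in _ , ¬' α c ∷ rg , λ v ⊨f → case v ⊨? α of λ where
       (yes ⊨α) → there (αf⊨g v (⊨α ∷ ⊨f))
       (no ⊭α)  → here ⊭α

valid-L∧ : Valid (φ ∷ ψ ∷ Γ) Δ → Valid (φ ∧' ψ ∷ Γ) Δ
valid-L∧ ⊨φψΓΔ (r ∧' s ∷ rf) =
  let g , rg , abf⊨g = ⊨φψΓΔ (r ∷ s ∷ rf)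
  in g , rg , λ { v ((⊨a , ⊨b) ∷ ⊨f) → abf⊨g v (⊨a ∷ ⊨b ∷ ⊨f) }

-- A classical Λ is its own only resolution, so the two premises agree on it: this is
-- why R∧ and L∨ demand classical side formulas.
valid-R∧ : All Classical Λ → Valid Γ (φ ∷ Λ) → Valid Γ (ψ ∷ Λ) → Valid Γ (φ ∧' ψ ∷ Λ)
valid-R∧ cΛ ⊨ΓφΛ ⊨ΓψΛ rf
  with _ ∷ _ , r ∷ rg , f⊨aΛ ← ⊨ΓφΛ rf | _ ∷ _ , s ∷ rg′ , f⊨bΛ ← ⊨ΓψΛ rf
  with refl ← classical-resolutions cΛ rg | refl ← classical-resolutions cΛ rg′ =
  _ , r ∧' s ∷ rg , λ v ⊨f → both (f⊨aΛ v ⊨f) (f⊨bΛ v ⊨f)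
  where
  both : ∀ {v a b} → Any (v ⊨_) (a ∷ Λ) → Any (v ⊨_) (b ∷ Λ) → Any (v ⊨_) (a ∧' b ∷ Λ)
  both (here ⊨a)  (here ⊨b)  = here (⊨a , ⊨b)
  both (there ⊨Λ) _          = there ⊨Λ
  both _          (there ⊨Λ) = there ⊨Λ

valid-L∨ : All Classical Λ → Valid (φ ∷ Γ) Λ → Valid (ψ ∷ Γ) Λ → Valid (φ ∨' ψ ∷ Γ) Λ
valid-L∨ cΛ ⊨φΓΛ ⊨ψΓΛ (r ∨' s ∷ rf)
  with _ , rg , af⊨Λ ← ⊨φΓΛ (r ∷ rf) | _ , rg′ , bf⊨Λ ← ⊨ψΓΛ (s ∷ rf)
  with refl ← classical-resolutions cΛ rg | refl ← classical-resolutions cΛ rg′ =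
  _ , rg , λ where
    v (inj₁ ⊨a ∷ ⊨f) → af⊨Λ v (⊨a ∷ ⊨f)
    v (inj₂ ⊨b ∷ ⊨f) → bf⊨Λ v (⊨b ∷ ⊨f)

valid-R∨ : Valid Γ (φ ∷ ψ ∷ Δ) → Valid Γ (φ ∨' ψ ∷ Δ)
valid-R∨ ⊨ΓφψΔ rf with _ ∷ _ ∷ _ , r ∷ s ∷ rg , f⊨abg ← ⊨ΓφψΔ rf =
  _ , r ∨' s ∷ rg , λ v ⊨f → either (f⊨abg v ⊨f)
  where
  either : ∀ {v a b g} → Any (v ⊨_) (a ∷ b ∷ g) → Any (v ⊨_) (a ∨' b ∷ g)
  either (here ⊨a)          = here (inj₁ ⊨a)
  either (there (here ⊨b))  = here (inj₂ ⊨b)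
  either (there (there ⊨g)) = there ⊨g

valid-L⩔ : ∀ χ → Valid (plug χ φL ∷ Γ) Δ → Valid (plug χ φR ∷ Γ) Δ →
           Valid (plug χ (φL ⩔ φR) ∷ Γ) Δ
valid-L⩔ χ ⊨L ⊨R (r ∷ rf) =
  [ (λ r′ → ⊨L (r′ ∷ rf)) , (λ r′ → ⊨R (r′ ∷ rf)) ] (resolution-plug-⩔ χ r)

valid-R-plug : ∀ χ → (∀ {a} → Resolution η a → Resolution η′ a) →
               Valid Γ (plug χ η ∷ Δ) → Valid Γ (plug χ η′ ∷ Δ)
valid-R-plug χ ρ ⊨ΓηΔ rf with _ , r ∷ rg , f⊨g ← ⊨ΓηΔ rf =
  _ , resolution-plug χ ρ r ∷ rg , f⊨g

valid-++ : Valid Γ Δ → Valid Γ (Δ ++ Δ′)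
valid-++ {Δ′ = Δ′} ⊨ΓΔ rf =
  let _ , rg , f⊨g = ⊨ΓΔ rf
      _ , rg′      = resolutions-exist Δ′
  in _ , Pointwise.++⁺ rg rg′ , λ v ⊨f → ++⁺ˡ (f⊨g v ⊨f)

valid-cut : Valid Γ (φ ∷ Δ) → Valid (φ ∷ Π) Σ → Valid (Π ++ Γ) (Δ ++ Σ)
valid-cut {Π = Π} ⊨ΓφΔ ⊨φΠΣ rf
  with fΠ , _ , refl , rΠ , rΓ ← Pointwise-++⁻ Π rf
  with _ ∷ gΔ , r ∷ rgΔ , fΓ⊨agΔ ← ⊨ΓφΔ rΓ
  with _ , rgΣ , afΠ⊨gΣ ← ⊨φΠΣ (r ∷ rΠ) =
  _ , Pointwise.++⁺ rgΔ rgΣ , λ v ⊨f → case fΓ⊨agΔ v (++⁻ʳ fΠ ⊨f) of λ where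
    (here ⊨a)   → ++⁺ʳ gΔ (afΠ⊨gΣ v (⊨a ∷ ++⁻ˡ fΠ ⊨f))
    (there ⊨gΔ) → ++⁺ˡ ⊨gΔ

sound : GT b Γ Δ → Valid Γ Δ
sound (perm p q d)     = valid-perm p q (sound d)
sound (ax n)           = valid-ax n
sound ax⊥              = valid-ax⊥
sound (L¬ c d)         = valid-L¬ c (sound d)
sound (R¬ c d)         = valid-R¬ c (sound d)
sound (L∧ d)           = valid-L∧ (sound d)
sound (R∧ cΛ d₁ d₂)    = valid-++ (valid-R∧ cΛ (sound d₁) (sound d₂))
sound (L∨ cΛ d₁ d₂)    = valid-++ (valid-L∨ cΛ (sound d₁) (sound d₂))
sound (R∨ d)           = valid-R∨ (sound d)
sound (L⩔ χ _ _ d₁ d₂) = valid-L⩔ χ (sound d₁) (sound d₂)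
sound (R⩔ˡ χ _ _ d)    = valid-R-plug χ inl (sound d)
sound (R⩔ʳ χ _ _ d)    = valid-R-plug χ inr (sound d)
sound (cut φ d₁ d₂)    = valid-cut (sound d₁) (sound d₂)

-- Cut-free completeness for classical sequents

vars : List ℕ → List Formula
vars = map var

vars-classical : ∀ A → All Classical (vars A)
vars-classical []      = []
vars-classical (n ∷ A) = var n ∷ vars-classical A

Refutes : Valuation → List ℕ × List ℕ → Set
Refutes v (A , B) = All (T ∘ v) A × All (¬_ ∘ T ∘ v) B

-- decompose-left/right below pass every atomic leaf s′ that the invertible rules
-- reach from the atoms s to their continuation, together with this certificate.
Refines : (Valuation → Set) → (s s′ : List ℕ × List ℕ) → Set
Refines P s s′ = ∀ v → Refutes v s′ → P v × Refutes v s

module _ {P Q : Valuation → Set} {s s′ : List ℕ × List ℕ} where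

  refines-map : (∀ {v} → P v → Q v) → Refines P s s′ → Refines Q s s′
  refines-map P⇒Q s′⊑s v ref with p , ref′ ← s′⊑s v ref = P⇒Q p , ref′

  refines-trans : ∀ {s″} → Refines P s s′ → Refines Q s′ s″ → Refines (λ v → P v × Q v) s s″
  refines-trans s′⊑s s″⊑s′ v ref
    with q , ref′ ← s″⊑s′ v ref
    with p , ref″ ← s′⊑s v ref′ = (p , q) , ref″

decompose-left : Classical α → All Classical Δ →
  (∀ {A′ B′} → Refines (_⊨ α) (A , B) (A′ , B′) → GT false (Γ ++ vars A′) (Δ ++ vars B′)) →
  GT false (α ∷ Γ ++ vars A) (Δ ++ vars B)
decompose-right : Classical α → All Classical Δ →
  (∀ {A′ B′} → Refines (¬_ ∘ (_⊨ α)) (A , B) (A′ , B′) → GT false (Γ ++ vars A′) (Δ ++ vars B′)) →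
  GT false (Γ ++ vars A) (α ∷ Δ ++ vars B)

decompose-left {A = A} {Γ = Γ} (var n) cΔ k =
  permˡ (shift (var n) Γ (vars A)) (k {n ∷ A} λ { v (⊨n ∷ ⊨A , ⊭B) → ⊨n , ⊨A , ⊭B })
decompose-left ⊥' cΔ k = ax⊥
decompose-left (¬' c) cΔ k = L¬ c (decompose-right c cΔ k)
decompose-left (cα ∧' cβ) cΔ k =
  L∧ (decompose-left cα cΔ λ r₁ →
      decompose-left cβ cΔ λ r₂ → k (refines-trans r₁ r₂))
decompose-left {B = B} (cα ∨' cβ) cΔ k =
  L∨′ (++⁺ cΔ (vars-classical B))
      (decompose-left cα cΔ (k ∘ refines-map inj₁))
      (decompose-left cβ cΔ (k ∘ refines-map inj₂))

decompose-right {Δ = Δ} {B = B} (var n) cΔ k =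
  permʳ (shift (var n) Δ (vars B)) (k {B′ = n ∷ B} λ { v (⊨A , ⊭n ∷ ⊭B) → ⊭n , ⊨A , ⊭B })
-- ⊥ on the right leaves no atom behind, so its leaf is weakened back.
decompose-right ⊥' cΔ k = weakenʳ (k λ v ref → (λ ()) , ref)
decompose-right (¬' c) cΔ k = R¬ c (decompose-left c cΔ (k ∘ refines-map λ ⊨α ⊭α → ⊭α ⊨α))
decompose-right {B = B} (cα ∧' cβ) cΔ k =
  R∧′ (++⁺ cΔ (vars-classical B))
      (decompose-right cα cΔ (k ∘ refines-map (_∘ proj₁)))
      (decompose-right cβ cΔ (k ∘ refines-map (_∘ proj₂)))
decompose-right (cα ∨' cβ) cΔ k =
  R∨ (decompose-right cα (cβ ∷ cΔ) λ r₁ →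
      decompose-right cβ cΔ λ r₂ → k (refines-map (uncurry [_,_]) (refines-trans r₁ r₂)))

decompose-lefts : All Classical Γ → All Classical Δ →
  (∀ {A′ B′} → Refines (λ v → All (v ⊨_) Γ) (A , B) (A′ , B′) → GT false (vars A′) (Δ ++ vars B′)) →
  GT false (Γ ++ vars A) (Δ ++ vars B)
decompose-lefts []         cΔ k = k λ v ref → [] , ref
decompose-lefts (cα ∷ cΓ) cΔ k =
  decompose-left cα cΔ λ r₁ →
  decompose-lefts cΓ cΔ λ r₂ → k (refines-map (uncurry _∷_) (refines-trans r₁ r₂))

decompose-rights : All Classical Δ →
  (∀ {A′ B′} → Refines (λ v → All (¬_ ∘ (v ⊨_)) Δ) (A , B) (A′ , B′) → GT false (vars A′) (vars B′)) →
  GT false (vars A) (Δ ++ vars B)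
decompose-rights []         k = k λ v ref → [] , ref
decompose-rights (cα ∷ cΔ) k =
  decompose-right cα cΔ λ r₁ →
  decompose-rights cΔ λ r₂ → k (refines-map (uncurry _∷_) (refines-trans r₁ r₂))

atomic-derivable-or-refuted : ∀ A B → GT false (vars A) (vars B) ⊎ ∃[ v ] Refutes v (A , B)
atomic-derivable-or-refuted A B with any? (_∈? A) B
... | yes shared =
  let n , n∈B , n∈A = find shared in inj₁ (ax-∈ (∈-map⁺ var n∈A) (∈-map⁺ var n∈B))
... | no disjoint =
  inj₂ (v , All.tabulate fromWitness , All.tabulate λ n∈B ⊨n → disjoint (lose n∈B (toWitness ⊨n)))
  where
  v : Valuation
  v n = isYes (n ∈? A)

complete : All Classical Γ → All Classical Δ → Entails Γ Δ → GT false Γ Δ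
complete {Γ = Γ} {Δ = Δ} cΓ cΔ Γ⊨Δ =
  subst₂ (GT false) (++-identityʳ Γ) (++-identityʳ Δ)
    (decompose-lefts cΓ cΔ λ r₁ →
     decompose-rights cΔ λ {A} {B} r₂ →
     [ id , ⊥-elim ∘ no-countermodel r₁ r₂ ]′ (atomic-derivable-or-refuted A B))
  where
  no-countermodel : ∀ {s s′} →
    Refines (λ v → All (v ⊨_) Γ) ([] , []) s → Refines (λ v → All (¬_ ∘ (v ⊨_)) Δ) s s′ →
    ∃[ v ] Refutes v s′ → ⊥
  no-countermodel r₁ r₂ (v , ref) with ⊭Δ , ref′ ← r₂ v ref with ⊨Γ , _ ← r₁ v ref′ =
    All¬⇒¬Any ⊭Δ (Γ⊨Δ v ⊨Γ)

-- Lifting cut-free derivations along resolutions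

_∘ᶜ_ : Ctx → Ctx → Ctx
hole     ∘ᶜ χ′ = χ′
(χ ∧ˡ ψ) ∘ᶜ χ′ = (χ ∘ᶜ χ′) ∧ˡ ψ
(φ ∧ʳ χ) ∘ᶜ χ′ = φ ∧ʳ (χ ∘ᶜ χ′)
(χ ∨ˡ ψ) ∘ᶜ χ′ = (χ ∘ᶜ χ′) ∨ˡ ψ
(φ ∨ʳ χ) ∘ᶜ χ′ = φ ∨ʳ (χ ∘ᶜ χ′)
(χ ⩔ˡ ψ) ∘ᶜ χ′ = (χ ∘ᶜ χ′) ⩔ˡ ψ
(φ ⩔ʳ χ) ∘ᶜ χ′ = φ ⩔ʳ (χ ∘ᶜ χ′)

plug-∘ᶜ : ∀ χ χ′ η → plug (χ ∘ᶜ χ′) η ≡ plug χ (plug χ′ η)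
plug-∘ᶜ hole     χ′ η = refl
plug-∘ᶜ (χ ∧ˡ ψ) χ′ η = cong (_∧' ψ) (plug-∘ᶜ χ χ′ η)
plug-∘ᶜ (φ ∧ʳ χ) χ′ η = cong (φ ∧'_) (plug-∘ᶜ χ χ′ η)
plug-∘ᶜ (χ ∨ˡ ψ) χ′ η = cong (_∨' ψ) (plug-∘ᶜ χ χ′ η)
plug-∘ᶜ (φ ∨ʳ χ) χ′ η = cong (φ ∨'_) (plug-∘ᶜ χ χ′ η)
plug-∘ᶜ (χ ⩔ˡ ψ) χ′ η = cong (_⩔ ψ) (plug-∘ᶜ χ χ′ η)
plug-∘ᶜ (φ ⩔ʳ χ) χ′ η = cong (φ ⩔_) (plug-∘ᶜ χ χ′ η)

lift-left : ∀ φ χ → (∀ {a} → Resolution φ a → GT b (plug χ a ∷ Γ) Δ) → GT b (plug χ φ ∷ Γ) Δ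
lift-left-∘ᶜ : ∀ φ χ χ′ → (∀ {a} → Resolution φ a → GT b (plug χ (plug χ′ a) ∷ Γ) Δ) →
               GT b (plug χ (plug χ′ φ) ∷ Γ) Δ

lift-left (var n)  χ k = k (var n)
lift-left ⊥'       χ k = k ⊥'
lift-left (¬' α c) χ k = k (¬' α c)
lift-left (φ ∧' ψ) χ k =
  lift-left-∘ᶜ φ χ (hole ∧ˡ ψ) λ r → lift-left-∘ᶜ ψ χ (_ ∧ʳ hole) λ s → k (r ∧' s)
lift-left (φ ∨' ψ) χ k =
  lift-left-∘ᶜ φ χ (hole ∨ˡ ψ) λ r → lift-left-∘ᶜ ψ χ (_ ∨ʳ hole) λ s → k (r ∨' s)
lift-left (φ ⩔ ψ)  χ k = L⩔ χ φ ψ (lift-left φ χ (k ∘ inl)) (lift-left ψ χ (k ∘ inr))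

lift-left-∘ᶜ {b = b} {Γ = Γ} {Δ = Δ} φ χ χ′ k =
  subst (λ θ → GT b (θ ∷ Γ) Δ) (plug-∘ᶜ χ χ′ φ)
    (lift-left φ (χ ∘ᶜ χ′) λ r → subst (λ θ → GT b (θ ∷ Γ) Δ) (sym (plug-∘ᶜ χ χ′ _)) (k r))

lift-right : Resolution φ a → ∀ χ → GT b Γ (plug χ a ∷ Δ) → GT b Γ (plug χ φ ∷ Δ)
lift-right-∘ᶜ : Resolution φ a → ∀ χ χ′ → GT b Γ (plug χ (plug χ′ a) ∷ Δ) →
                GT b Γ (plug χ (plug χ′ φ) ∷ Δ)

lift-right (var n)  χ d = d
lift-right ⊥'       χ d = d
lift-right (¬' α c) χ d = d
lift-right (r ∧' s) χ d = lift-right-∘ᶜ r χ (hole ∧ˡ _) (lift-right-∘ᶜ s χ (_ ∧ʳ hole) d)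
lift-right (r ∨' s) χ d = lift-right-∘ᶜ r χ (hole ∨ˡ _) (lift-right-∘ᶜ s χ (_ ∨ʳ hole) d)
lift-right (inl r)  χ d = R⩔ˡ χ _ _ (lift-right r χ d)
lift-right (inr r)  χ d = R⩔ʳ χ _ _ (lift-right r χ d)

lift-right-∘ᶜ {φ = φ} {b = b} {Γ = Γ} {Δ = Δ} r χ χ′ d =
  subst (λ θ → GT b Γ (θ ∷ Δ)) (plug-∘ᶜ χ χ′ φ)
    (lift-right r (χ ∘ᶜ χ′) (subst (λ θ → GT b Γ (θ ∷ Δ)) (sym (plug-∘ᶜ χ χ′ _)) d))

lift-lefts : ∀ Γ → (∀ {f} → Resolutions Γ f → GT b (Θ ++ f) Δ) → GT b (Θ ++ Γ) Δ
lift-lefts []      k = k []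
lift-lefts {Θ = Θ} (φ ∷ Γ) k =
  permˡ (↭-sym (shift φ Θ Γ))
    (lift-left φ hole λ r → lift-lefts Γ λ rf → permˡ (shift _ Θ _) (k (r ∷ rf)))

lift-rights : Resolutions Δ g → GT b Γ (Θ ++ g) → GT b Γ (Θ ++ Δ)
lift-rights [] d = d
lift-rights {Δ = φ ∷ Δ} {Θ = Θ} (r ∷ rg) d =
  permʳ (↭-sym (shift φ Θ Δ)) (lift-right r hole (lift-rights rg (permʳ (shift _ Θ _) d)))

mainTheorem9 : (Γ Δ : List Formula) → GT true Γ Δ → GT false Γ Δ
mainTheorem9 Γ Δ d = lift-lefts {Θ = []} Γ λ rf →
  let g , rg , f⊨g = sound d rf
  in lift-rights {Θ = []} rg (complete (resolutions-classical rf) (resolutions-classical rg) f⊨g)
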